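{- For every finite simple undirected graph $G$, letting $k=\chi(G^2)$, we have $\chi_o^+(G)\le 2^k-1$.
   Context: An oriented graph is a digraph with no loops, no multiple arcs and no pair of opposite arcs; an orientation of an undirected graph $G$ gives each edge one of its two directions. A homomorphism between oriented graphs is a vertex map sending arcs to arcs. The upper oriented chromatic number $\chi_o^+(G)$ is the smallest order of an oriented graph $\vec T$ such that every orientation of $G$ admits a homomorphism to $\vec T$. The square $G^2$ of $G$ has vertex set $V(G)$, with $u,v$ adjacent iff their distance in $G$ is 1 or 2. $\chi$ denotes the (proper) chromatic number. -}

module Defs where

open import Data.Nat using (ℕ; _≤_)
open import Data.Fin using (Fin)
open import Data.Bool using (Bool; T)
open import Data.Product using (Σ; _×_; ∃-syntax)
open import Data.Sum using (_⊎_)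
open import Relation.Nullary using (¬_)
open import Relation.Binary.PropositionalEquality using (_≡_; _≢_)

record SimpleGraph (n : ℕ) : Set where
  field
    adj     : Fin n → Fin n → Bool
    symm    : ∀ u v → adj u v ≡ adj v u
    irrefl  : ∀ u → ¬ T (adj u u)

open SimpleGraph public

Adj : ∀ {n} → SimpleGraph n → Fin n → Fin n → Set
Adj G u v = T (adj G u v)

SqAdj : ∀ {n} → SimpleGraph n → Fin n → Fin n → Set
SqAdj G u v = u ≢ v × (Adj G u v ⊎ ∃[ w ] (Adj G u w × Adj G w v))

ProperColouring : ∀ {n} → (Fin n → Fin n → Set) → (k : ℕ) → Set
ProperColouring {n} E k =
  Σ (Fin n → Fin k) (λ c → ∀ u v → E u v → c u ≢ c v)

Colourable : ∀ {n} → (Fin n → Fin n → Set) → ℕ → Set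
Colourable E k = ProperColouring E k

IsChromaticNumber : ∀ {n} → (Fin n → Fin n → Set) → ℕ → Set
IsChromaticNumber E k = Colourable E k × (∀ j → Colourable E j → k ≤ j)

-- An oriented graph on Fin m: no loops, no pair of opposite arcs
-- (multiple arcs are excluded by representation as a relation).
record OrientedGraph (m : ℕ) : Set where
  field
    arc      : Fin m → Fin m → Bool
    noLoop   : ∀ u → ¬ T (arc u u)
    noOpp    : ∀ u v → T (arc u v) → ¬ T (arc v u)

open OrientedGraph public

record Orientation {n : ℕ} (G : SimpleGraph n) : Set where
  field
    oarc     : Fin n → Fin n → Bool
    alongEdge : ∀ u v → T (oarc u v) → Adj G u v
    covers   : ∀ u v → Adj G u v → T (oarc u v) ⊎ T (oarc v u)
    oneWay   : ∀ u v → T (oarc u v) → ¬ T (oarc v u)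

open Orientation public

Hom : ∀ {n m} {G : SimpleGraph n} → Orientation G → OrientedGraph m → Set
Hom {n} {m} O Tg =
  Σ (Fin n → Fin m) (λ f → ∀ u v → T (oarc O u v) → T (arc Tg (f u) (f v)))

Universal : ∀ {n} → SimpleGraph n → ℕ → Set
Universal {n} G m =
  Σ (OrientedGraph m) (λ Tg → (O : Orientation G) → Hom O Tg)

IsUpperOrientedChromaticNumber : ∀ {n} → SimpleGraph n → ℕ → Set
IsUpperOrientedChromaticNumber G m = Universal G m × (∀ j → Universal G j → m ≤ j)

-- Fix a proper k-colouring c of G². The target T_k has as vertices the pairs (i, X) with
-- i a colour and X a set of colours greater than i, so it has 2^k − 1 vertices; for
-- colours i < j the arc between (i, X) and (j, Y) goes forwards iff j ∈ X. Given an
-- orientation, send v to (c v, the colours above c v of the out-neighbours of v). An arc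
-- u → v with c u < c v is preserved since c v ∈ X_u. If c v < c u then c u ∉ X_v: an
-- out-neighbour of v coloured c u would be at distance at most 2 from u in G, hence equal
-- to u, but v → u is not an arc.
module Submission where

open import Defs
open import Data.Nat using (ℕ; zero; suc; _+_; _≤_; _∸_; _^_; s<s⁻¹)
open import Data.Nat.Properties using (+-∸-assoc; +-identityʳ; m^n>0)
open import Data.Fin using (Fin; zero; suc; _<_; _↑ˡ_; _↑ʳ_; splitAt; funToFin; finToFun; _≟_)
open import Data.Fin.Properties using (splitAt-↑ˡ; splitAt-↑ʳ; finToFun-funToFin; 2↔Bool; <-cmp; any?)
open import Data.Bool using (Bool; true; false; not; T; T?)
open import Data.Product using (_,_)
open import Data.Sum using (inj₁; inj₂)
open import Function using (_∘_; Inverse)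
open import Relation.Binary using (tri<; tri≈; tri>)
open import Relation.Nullary using (¬_; yes; no; isYes; contradiction)
open import Relation.Nullary.Decidable using (_×-dec_; fromWitness; fromWitnessFalse)
open import Relation.Binary.PropositionalEquality using (_≡_; _≢_; refl; sym; cong; subst; module ≡-Reasoning)

open Inverse 2↔Bool using () renaming (to to toBool; from to fromBool; strictlyInverseˡ to toBool∘fromBool)

order : ℕ → ℕ
order zero    = 0
order (suc k) = 2 ^ k + order k

order≡2^k∸1 : ∀ k → order k ≡ 2 ^ k ∸ 1
order≡2^k∸1 zero    = refl
order≡2^k∸1 (suc k) = begin
  2 ^ k + order k           ≡⟨ cong (2 ^ k +_) (order≡2^k∸1 k) ⟩
  2 ^ k + (2 ^ k ∸ 1)       ≡⟨ +-∸-assoc (2 ^ k) (m^n>0 2 k) ⟨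
  2 ^ k + 2 ^ k ∸ 1         ≡⟨ cong (λ x → 2 ^ k + x ∸ 1) (+-identityʳ (2 ^ k)) ⟨
  2 ^ k + (2 ^ k + 0) ∸ 1   ∎
  where open ≡-Reasoning

-- A vertex of T_{k+1} in the first block Fin (2 ^ k) has colour 0 and encodes, via finToFun,
-- the set of colours 1, …, k towards which it sends its arcs; the second block is T_k with
-- every colour shifted up by one.
colour : ∀ k → Fin (order k) → Fin k
colour (suc k) x with splitAt (2 ^ k) x
... | inj₁ _ = zero
... | inj₂ y = suc (colour k y)

pointsTo : ∀ {k} → Fin (2 ^ k) → Fin k → Bool
pointsTo a j = toBool (finToFun a j)

targetArc : ∀ k → Fin (order k) → Fin (order k) → Bool
targetArc (suc k) x y with splitAt (2 ^ k) x | splitAt (2 ^ k) y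
... | inj₁ _ | inj₁ _ = false
... | inj₁ a | inj₂ y = pointsTo a (colour k y)
... | inj₂ x | inj₁ a = not (pointsTo a (colour k x))
... | inj₂ x | inj₂ y = targetArc k x y

T⇒¬T-not : ∀ b → T b → ¬ T (not b)
T⇒¬T-not true _ ()

targetArc-irrefl : ∀ k (x : Fin (order k)) → ¬ T (targetArc k x x)
targetArc-irrefl (suc k) x with splitAt (2 ^ k) x
... | inj₁ _ = λ ()
... | inj₂ x′ = targetArc-irrefl k x′

targetArc-asym : ∀ k (x y : Fin (order k)) → T (targetArc k x y) → ¬ T (targetArc k y x)
targetArc-asym (suc k) x y with splitAt (2 ^ k) x | splitAt (2 ^ k) y
... | inj₁ _  | inj₁ _  = λ ()
... | inj₁ a  | inj₂ y′ = T⇒¬T-not (pointsTo a (colour k y′))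
... | inj₂ x′ | inj₁ a  = λ p q → T⇒¬T-not (pointsTo a (colour k x′)) q p
... | inj₂ x′ | inj₂ y′ = targetArc-asym k x′ y′

target : ∀ k → OrientedGraph (order k)
target k = record { arc = targetArc k ; noLoop = targetArc-irrefl k ; noOpp = targetArc-asym k }

code : ∀ k → Fin k → (Fin k → Bool) → Fin (order k)
code (suc k) zero    g = funToFin (fromBool ∘ g ∘ suc) ↑ˡ order k
code (suc k) (suc i) g = 2 ^ k ↑ʳ code k i (g ∘ suc)

colour-code : ∀ k i (g : Fin k → Bool) → colour k (code k i g) ≡ i
colour-code (suc k) zero    g
  rewrite splitAt-↑ˡ (2 ^ k) (funToFin (fromBool ∘ g ∘ suc)) (order k) = refl
colour-code (suc k) (suc i) g
  rewrite splitAt-↑ʳ (2 ^ k) (order k) (code k i (g ∘ suc)) = cong suc (colour-code k i (g ∘ suc))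

pointsTo-funToFin : ∀ {k} (g : Fin k → Bool) j → pointsTo (funToFin (fromBool ∘ g)) j ≡ g j
pointsTo-funToFin g j = begin
  toBool (finToFun (funToFin (fromBool ∘ g)) j) ≡⟨ cong toBool (finToFun-funToFin (fromBool ∘ g) j) ⟩
  toBool (fromBool (g j))                       ≡⟨ toBool∘fromBool (g j) ⟩
  g j                                           ∎
  where open ≡-Reasoning

targetArc-code-< : ∀ k {i j} (g h : Fin k → Bool) → i < j →
                   targetArc k (code k i g) (code k j h) ≡ g j
targetArc-code-< (suc k) {zero} {suc j} g h _
  rewrite splitAt-↑ˡ (2 ^ k) (funToFin (fromBool ∘ g ∘ suc)) (order k)
        | splitAt-↑ʳ (2 ^ k) (order k) (code k j (h ∘ suc))
        | colour-code k j (h ∘ suc) = pointsTo-funToFin (g ∘ suc) j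
targetArc-code-< (suc k) {suc i} {suc j} g h i<j
  rewrite splitAt-↑ʳ (2 ^ k) (order k) (code k i (g ∘ suc))
        | splitAt-↑ʳ (2 ^ k) (order k) (code k j (h ∘ suc)) =
  targetArc-code-< k (g ∘ suc) (h ∘ suc) (s<s⁻¹ i<j)

targetArc-code-> : ∀ k {i j} (g h : Fin k → Bool) → j < i →
                   targetArc k (code k i g) (code k j h) ≡ not (h i)
targetArc-code-> (suc k) {suc i} {zero} g h _
  rewrite splitAt-↑ʳ (2 ^ k) (order k) (code k i (g ∘ suc))
        | splitAt-↑ˡ (2 ^ k) (funToFin (fromBool ∘ h ∘ suc)) (order k)
        | colour-code k i (g ∘ suc) = cong not (pointsTo-funToFin (h ∘ suc) i)
targetArc-code-> (suc k) {suc i} {suc j} g h j<i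
  rewrite splitAt-↑ʳ (2 ^ k) (order k) (code k i (g ∘ suc))
        | splitAt-↑ʳ (2 ^ k) (order k) (code k j (h ∘ suc)) =
  targetArc-code-> k (g ∘ suc) (h ∘ suc) (s<s⁻¹ j<i)

module _ {n k} {G : SimpleGraph n} (c : Fin n → Fin k) (proper : ∀ u v → SqAdj G u v → c u ≢ c v)
         (O : Orientation G) where

  outColours : Fin n → Fin k → Bool
  outColours v j = isYes (any? λ w → (c w ≟ j) ×-dec T? (oarc O v w))

  colour≢-along-arc : ∀ {u v} → T (oarc O u v) → c u ≢ c v
  colour≢-along-arc {u} {v} u→v = proper u v (u≢v , inj₁ uv)
    where
    uv : Adj G u v
    uv = alongEdge O u v u→v
    u≢v : u ≢ v
    u≢v refl = irrefl G u uv

  colour≢-along-back-path : ∀ {u v w} → T (oarc O u v) → T (oarc O v w) → c w ≢ c u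
  colour≢-along-back-path {u} {v} {w} u→v v→w with u ≟ w
  ... | yes refl = λ _ → oneWay O u v u→v v→w
  ... | no u≢w   = proper u w (u≢w , inj₂ (v , alongEdge O u v u→v , alongEdge O v w v→w)) ∘ sym

  homToTarget : Hom O (target k)
  homToTarget = (λ v → code k (c v) (outColours v)) , preserves
    where
    preserves : ∀ u v → T (oarc O u v) →
                T (targetArc k (code k (c u) (outColours u)) (code k (c v) (outColours v)))
    preserves u v u→v with <-cmp (c u) (c v)
    ... | tri< cu<cv _ _ = subst T (sym (targetArc-code-< k _ _ cu<cv)) (fromWitness (v , refl , u→v))
    ... | tri≈ _ cu≡cv _ = contradiction cu≡cv (colour≢-along-arc u→v)
    ... | tri> _ _ cv<cu = subst T (sym (targetArc-code-> k _ _ cv<cu))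
      (fromWitnessFalse λ (w , cw≡cu , v→w) → colour≢-along-back-path u→v v→w cw≡cu)

universal : ∀ {n} (G : SimpleGraph n) k → Colourable (SqAdj G) k → Universal G (order k)
universal G k (c , proper) = target k , homToTarget c proper

proposition2 : (n : ℕ) (G : SimpleGraph n) (k m : ℕ) →
    IsChromaticNumber (SqAdj G) k →
    IsUpperOrientedChromaticNumber G m →
    m ≤ 2 ^ k ∸ 1
proposition2 n G k m (colourable , _) (_ , minimal) =
  subst (m ≤_) (order≡2^k∸1 k) (minimal (order k) (universal G k colourable))
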